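{- Let $n\geq 1$ be an integer and let $P_n=\langle a_0,\dots,a_k\rangle$ be the $n$-th $P$-sequence. Then (1) $\sum_{i=0}^k a_i i^s=0$ for $s=0,1,\dots,n-1$; and (2) $\operatorname{sgn}\sum_{i=0}^k a_i i^n=(-1)^n$.
   Context: Convention: $0^0=1$. $P$-sequences are defined recursively: $\langle 1,-1\rangle$ is a $P$-sequence; if $\langle a_0,\dots,a_k\rangle$ is a $P$-sequence with $a_0=-a_k$, then $\langle a_0,\dots,a_k,a_k,\dots,a_0\rangle$ is a $P$-sequence; if $\langle a_0,\dots,a_k\rangle$ is a $P$-sequence with $a_0=a_k$, then $\langle a_0,\dots,a_{k-1},0,-a_{k-1},\dots,-a_0\rangle$ is a $P$-sequence; and only sequences obtained by finitely many applications of these clauses are $P$-sequences. Ordering the $P$-sequences by increasing length, $P_n$ denotes the $n$-th one; thus $P_1=\langle 1,-1\rangle$, $P_2=\langle 1,-1,-1,1\rangle$, $P_3=\langle 1,-1,-1,0,1,1,-1\rangle$, and each $P_{n+1}$ is obtained from $P_n$ by whichever of the two clauses applies. -}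

module Defs where

open import Data.Nat as ℕ using (ℕ; zero; suc)
open import Data.Integer as ℤ using (ℤ; +_; -_; _+_; _*_; 0ℤ; 1ℤ)
open import Data.List using (List; []; _∷_; _++_; reverse; map; foldr; length; zipWith; upTo)
open import Relation.Nullary using (yes; no)

-- head and last of a list (P-sequences are never empty)
headZ : List ℤ → ℤ
headZ [] = 0ℤ
headZ (x ∷ _) = x

lastZ : List ℤ → ℤ
lastZ [] = 0ℤ
lastZ (x ∷ []) = x
lastZ (_ ∷ y ∷ ys) = lastZ (y ∷ ys)

initZ : List ℤ → List ℤ
initZ [] = []
initZ (x ∷ []) = []
initZ (x ∷ y ∷ ys) = x ∷ initZ (y ∷ ys)

clause1 : List ℤ → List ℤ
clause1 a = a ++ reverse a

clause2 : List ℤ → List ℤ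
clause2 a = initZ a ++ (0ℤ ∷ map -_ (reverse (initZ a)))

nextP : List ℤ → List ℤ
nextP a with headZ a ℤ.≟ (- lastZ a)
... | yes _ = clause1 a
... | no _ = clause2 a

-- P n : the n-th P-sequence (P 1 = ⟨1,-1⟩); P 0 is an unused dummy value
P : ℕ → List ℤ
P zero = []
P (suc zero) = 1ℤ ∷ - 1ℤ ∷ []
P (suc (suc n)) = nextP (P (suc n))

-- ∑_{i=0}^{k} a_i i^s, with 0^0 = 1 (ℤ._^_ gives i ^ 0 = 1)
moment : List ℤ → ℕ → ℤ
moment a s = foldr _+_ 0ℤ (zipWith (λ ai i → ai * ((+ i) ℤ.^ s)) a (upTo (length a)))

sgn : ℤ → ℤ
sgn (+ zero) = 0ℤ
sgn (+ suc _) = 1ℤ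
sgn ℤ.-[1+ _ ] = - 1ℤ

module Submission where

-- Read a sequence as the polynomial a(x) = Σ aᵢ xⁱ.  Both clauses multiply a(x) by 1 − xᵈ with d ≥ 1
-- (d is the length for clause (i), the length minus one for the palindromes of clause (ii)), so the
-- s-th moment of the new sequence is Σ aᵢ iˢ − Σ aᵢ (d + i)ˢ.  Expanding (d + i)ˢ, if the moments of a
-- below n vanish then those of the new sequence vanish up to n, and its (n+1)-th moment is
-- −(n+1)·d·Σ aᵢ iⁿ, of the opposite sign.  By induction, P_n is a palindrome or antipalindrome
-- starting with 1 whose moments below n vanish and whose n-th moment has sign (−1)ⁿ.

open import Defs
open import Data.Nat as ℕ using (ℕ; zero; suc; _≤_; _<_; z≤n; s≤s)
import Data.Nat.Properties as ℕP
open import Data.Integer as ℤ using (ℤ; +_; -_; _+_; _*_; _-_; 0ℤ; 1ℤ; _^_; -[1+_])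
import Data.Integer.Properties as ℤP
open import Data.Integer.Tactic.RingSolver using (solve-∀)
open import Data.List using (List; []; _∷_; _++_; reverse; map; foldr; length; zipWith; applyUpTo; [_])
import Data.List.Properties as LP
open import Data.Product using (Σ; _×_; _,_; proj₁; proj₂)
open import Data.Sum using (_⊎_; inj₁; inj₂)
open import Relation.Binary.PropositionalEquality
  using (_≡_; _≢_; refl; sym; trans; cong; cong₂; subst; module ≡-Reasoning)
open import Relation.Nullary using (yes; no; contradiction)
open ≡-Reasoning

weightedSum : List ℤ → (ℕ → ℤ) → ℤ
weightedSum []       F = 0ℤ
weightedSum (x ∷ xs) F = x * F 0 + weightedSum xs (λ i → F (suc i))

moment′ : List ℤ → ℕ → ℤ
moment′ a s = weightedSum a (λ i → (+ i) ^ s)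

moment≡moment′ : ∀ a s → moment a s ≡ moment′ a s
moment≡moment′ a s = go a (λ i → i)
  where
  go : ∀ a (f : ℕ → ℕ) →
       foldr _+_ 0ℤ (zipWith (λ ai i → ai * (+ i) ^ s) a (applyUpTo f (length a)))
       ≡ weightedSum a (λ i → (+ f i) ^ s)
  go []       f = refl
  go (x ∷ a) f = cong (_+_ (x * (+ f 0) ^ s)) (go a (λ i → f (suc i)))

weightedSum-cong : ∀ a {F G : ℕ → ℤ} → (∀ i → F i ≡ G i) → weightedSum a F ≡ weightedSum a G
weightedSum-cong []       F≡G = refl
weightedSum-cong (x ∷ a) F≡G = cong₂ (λ u v → x * u + v) (F≡G 0) (weightedSum-cong a (λ i → F≡G (suc i)))

weightedSum-+ : ∀ a F G → weightedSum a (λ i → F i + G i) ≡ weightedSum a F + weightedSum a G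
weightedSum-+ []       F G = refl
weightedSum-+ (x ∷ a) F G = trans
  (cong (_+_ (x * (F 0 + G 0))) (weightedSum-+ a _ _))
  (regroup x (F 0) (G 0) _ _)
  where
  regroup : ∀ x f g u v → x * (f + g) + (u + v) ≡ (x * f + u) + (x * g + v)
  regroup = solve-∀

weightedSum-* : ∀ a c F → weightedSum a (λ i → c * F i) ≡ c * weightedSum a F
weightedSum-* []       c F = sym (ℤP.*-zeroʳ c)
weightedSum-* (x ∷ a) c F = trans
  (cong (_+_ (x * (c * F 0))) (weightedSum-* a c _))
  (factor x c (F 0) _)
  where
  factor : ∀ x c f u → x * (c * f) + c * u ≡ c * (x * f + u)
  factor = solve-∀

weightedSum-neg : ∀ a F → weightedSum (map (-_) a) F ≡ - weightedSum a F
weightedSum-neg []       F = refl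
weightedSum-neg (x ∷ a) F = trans
  (cong (_+_ ((- x) * F 0)) (weightedSum-neg a _))
  (factor x (F 0) _)
  where
  factor : ∀ x f u → (- x) * f + - u ≡ - (x * f + u)
  factor = solve-∀

weightedSum-++ : ∀ a b F → weightedSum (a ++ b) F ≡ weightedSum a F + weightedSum b (λ i → F (length a ℕ.+ i))
weightedSum-++ []       b F = sym (ℤP.+-identityˡ _)
weightedSum-++ (x ∷ a) b F = trans
  (cong (_+_ (x * F 0)) (weightedSum-++ a b _))
  (sym (ℤP.+-assoc (x * F 0) _ _))

Vanishing : List ℤ → ℕ → Set
Vanishing a n = ∀ s → s < n → moment′ a s ≡ 0ℤ

-- Interpolates between the moments of a (s = 0) and those of a shifted by c (j = 0).
mixedMoment : List ℤ → ℕ → ℤ → ℕ → ℤ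
mixedMoment a j c s = weightedSum a (λ i → (+ i) ^ j * (c + + i) ^ s)

mixedMoment-zero : ∀ a j c → mixedMoment a j c 0 ≡ moment′ a j
mixedMoment-zero a j c = weightedSum-cong a (λ i → ℤP.*-identityʳ _)

mixedMoment-suc : ∀ a j c s → mixedMoment a j c (suc s) ≡ mixedMoment a (suc j) c s + c * mixedMoment a j c s
mixedMoment-suc a j c s = begin
  mixedMoment a j c (suc s)
    ≡⟨ weightedSum-cong a (λ i → expand (+ i) c ((+ i) ^ j) ((c + + i) ^ s)) ⟩
  weightedSum a (λ i → (+ i) ^ suc j * (c + + i) ^ s + c * ((+ i) ^ j * (c + + i) ^ s))
    ≡⟨ weightedSum-+ a _ _ ⟩
  mixedMoment a (suc j) c s + weightedSum a (λ i → c * ((+ i) ^ j * (c + + i) ^ s))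
    ≡⟨ cong (_+_ (mixedMoment a (suc j) c s)) (weightedSum-* a c _) ⟩
  mixedMoment a (suc j) c s + c * mixedMoment a j c s ∎
  where
  expand : ∀ x c X Y → X * ((c + x) * Y) ≡ (x * X) * Y + c * (X * Y)
  expand = solve-∀

module _ (a : List ℤ) {n : ℕ} (vanishing : Vanishing a n) (c : ℤ) where

  mixedMoment-below : ∀ j s → j ℕ.+ s < n → mixedMoment a j c s ≡ 0ℤ
  mixedMoment-below j zero j+0<n =
    trans (mixedMoment-zero a j c) (vanishing j (subst (_< n) (ℕP.+-identityʳ j) j+0<n))
  mixedMoment-below j (suc s) j+s+1<n = begin
    mixedMoment a j c (suc s)                     ≡⟨ mixedMoment-suc a j c s ⟩
    mixedMoment a (suc j) c s + c * mixedMoment a j c s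
      ≡⟨ cong₂ (λ u v → u + c * v) (mixedMoment-below (suc j) s 1+j+s<n)
                                   (mixedMoment-below j s (ℕP.<⇒≤ 1+j+s<n)) ⟩
    0ℤ + c * 0ℤ                                   ≡⟨ cong (_+_ 0ℤ) (ℤP.*-zeroʳ c) ⟩
    0ℤ                                            ∎
    where
    1+j+s<n : suc j ℕ.+ s < n
    1+j+s<n = subst (_< n) (ℕP.+-suc j s) j+s+1<n

  mixedMoment-at : ∀ j s → j ℕ.+ s ≡ n → mixedMoment a j c s ≡ moment′ a n
  mixedMoment-at j zero j+0≡n =
    trans (mixedMoment-zero a j c) (cong (moment′ a) (trans (sym (ℕP.+-identityʳ j)) j+0≡n))
  mixedMoment-at j (suc s) j+s+1≡n = begin
    mixedMoment a j c (suc s)                     ≡⟨ mixedMoment-suc a j c s ⟩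
    mixedMoment a (suc j) c s + c * mixedMoment a j c s
      ≡⟨ cong₂ (λ u v → u + c * v) (mixedMoment-at (suc j) s 1+j+s≡n) (mixedMoment-below j s j+s<n) ⟩
    moment′ a n + c * 0ℤ                          ≡⟨ cong (_+_ (moment′ a n)) (ℤP.*-zeroʳ c) ⟩
    moment′ a n + 0ℤ                              ≡⟨ ℤP.+-identityʳ _ ⟩
    moment′ a n                                   ∎
    where
    1+j+s≡n : suc j ℕ.+ s ≡ n
    1+j+s≡n = trans (sym (ℕP.+-suc j s)) j+s+1≡n
    j+s<n : j ℕ.+ s < n
    j+s<n = subst (j ℕ.+ s <_) j+s+1≡n (ℕP.+-monoʳ-< j (ℕP.n<1+n s))

  mixedMoment-above : ∀ j s → j ℕ.+ s ≡ suc n → mixedMoment a j c s ≡ moment′ a (suc n) + + s * c * moment′ a n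
  mixedMoment-above j zero j+0≡1+n = begin
    mixedMoment a j c 0            ≡⟨ mixedMoment-zero a j c ⟩
    moment′ a j                    ≡⟨ cong (moment′ a) (trans (sym (ℕP.+-identityʳ j)) j+0≡1+n) ⟩
    moment′ a (suc n)              ≡⟨ sym (ℤP.+-identityʳ _) ⟩
    moment′ a (suc n) + + 0 * c * moment′ a n ∎
  mixedMoment-above j (suc s) j+s+1≡1+n = begin
    mixedMoment a j c (suc s)                     ≡⟨ mixedMoment-suc a j c s ⟩
    mixedMoment a (suc j) c s + c * mixedMoment a j c s
      ≡⟨ cong₂ (λ u v → u + c * v) (mixedMoment-above (suc j) s 1+j+s≡1+n)
                                   (mixedMoment-at j s (ℕP.suc-injective 1+j+s≡1+n)) ⟩
    moment′ a (suc n) + + s * c * moment′ a n + c * moment′ a n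
      ≡⟨ collect (moment′ a (suc n)) (+ s) c (moment′ a n) ⟩
    moment′ a (suc n) + (1ℤ + + s) * c * moment′ a n
      ≡⟨ cong (λ k → moment′ a (suc n) + k * c * moment′ a n) (sym (ℤP.pos-+ 1 s)) ⟩
    moment′ a (suc n) + + suc s * c * moment′ a n ∎
    where
    1+j+s≡1+n : suc j ℕ.+ s ≡ suc n
    1+j+s≡1+n = trans (sym (ℕP.+-suc j s)) j+s+1≡1+n
    collect : ∀ M′ s c M → M′ + s * c * M + c * M ≡ M′ + (1ℤ + s) * c * M
    collect = solve-∀

-- b(x) = (1 − xᵈ)·a(x) for the generating polynomials a(x) = Σ aᵢ xⁱ, b(x) = Σ bᵢ xⁱ.
record IsShiftDifference (d : ℕ) (a b : List ℤ) : Set where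
  constructor shiftDifference
  field
    weightedSum-shiftDifference : ∀ F → weightedSum b F ≡ weightedSum a F - weightedSum a (λ i → F (d ℕ.+ i))

module _ {d : ℕ} {a b : List ℤ} (b≡[1-xᵈ]a : IsShiftDifference d a b) where

  moment′-shiftDifference : ∀ s → moment′ b s ≡ moment′ a s - mixedMoment a 0 (+ d) s
  moment′-shiftDifference s = trans (IsShiftDifference.weightedSum-shiftDifference b≡[1-xᵈ]a (λ i → (+ i) ^ s))
    (cong (_-_ (moment′ a s)) (weightedSum-cong a (λ i →
      trans (cong (_^ s) (ℤP.pos-+ d i)) (sym (ℤP.*-identityˡ _)))))

  module _ {n : ℕ} (vanishing : Vanishing a n) where

    shiftDifference-vanishing : Vanishing b (suc n)
    shiftDifference-vanishing s s<1+n with ℕP.m<1+n⇒m<n∨m≡n s<1+n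
    ... | inj₁ s<n = begin
      moment′ b s                             ≡⟨ moment′-shiftDifference s ⟩
      moment′ a s - mixedMoment a 0 (+ d) s   ≡⟨ cong₂ _-_ (vanishing s s<n) (mixedMoment-below a vanishing (+ d) 0 s s<n) ⟩
      0ℤ - 0ℤ                                 ≡⟨⟩
      0ℤ                                      ∎
    ... | inj₂ refl = begin
      moment′ b s                             ≡⟨ moment′-shiftDifference s ⟩
      moment′ a s - mixedMoment a 0 (+ d) s   ≡⟨ cong (_-_ (moment′ a s)) (mixedMoment-at a vanishing (+ d) 0 s refl) ⟩
      moment′ a s - moment′ a s               ≡⟨ ℤP.+-inverseʳ (moment′ a s) ⟩
      0ℤ                                      ∎

    shiftDifference-top : moment′ b (suc n) ≡ - (+ suc n * + d * moment′ a n)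
    shiftDifference-top = begin
      moment′ b (suc n)                                  ≡⟨ moment′-shiftDifference (suc n) ⟩
      M′ - mixedMoment a 0 (+ d) (suc n)                 ≡⟨ cong (_-_ M′) (mixedMoment-above a vanishing (+ d) 0 (suc n) refl) ⟩
      M′ - (M′ + + suc n * + d * moment′ a n)            ≡⟨ cancel M′ (+ suc n * + d * moment′ a n) ⟩
      - (+ suc n * + d * moment′ a n)                    ∎
      where
      M′ = moment′ a (suc n)
      cancel : ∀ x y → x - (x + y) ≡ - y
      cancel = solve-∀

Signed : ℕ → List ℤ → Set
Signed n a = 0ℤ ℤ.< (- 1ℤ) ^ n * moment′ a n

positive-scale : ∀ m {x} → 0ℤ ℤ.< x → 0ℤ ℤ.< + suc m * x
positive-scale m {+ suc _} _ = ℤ.+<+ (s≤s z≤n)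
positive-scale m {+ zero} (ℤ.+<+ ())

shiftDifference-signed : ∀ {d n a b} → IsShiftDifference (suc d) a b → Vanishing a n → Signed n a → Signed (suc n) b
shiftDifference-signed {d} {n} {a} {b} b≡[1-xᵈ]a vanishing signed =
  subst (0ℤ ℤ.<_) (sym signs) (positive-scale n (positive-scale d signed))
  where
  signs : (- 1ℤ) ^ suc n * moment′ b (suc n) ≡ + suc n * (+ suc d * ((- 1ℤ) ^ n * moment′ a n))
  signs = begin
    (- 1ℤ) ^ suc n * moment′ b (suc n)
      ≡⟨ cong ((- 1ℤ) ^ suc n *_) (shiftDifference-top b≡[1-xᵈ]a vanishing) ⟩
    (- 1ℤ) * (- 1ℤ) ^ n * - (+ suc n * + suc d * moment′ a n)
      ≡⟨ reassociate (+ suc n) (+ suc d) ((- 1ℤ) ^ n) (moment′ a n) ⟩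
    + suc n * (+ suc d * ((- 1ℤ) ^ n * moment′ a n)) ∎
    where
    reassociate : ∀ k d e M → (- 1ℤ) * e * - (k * d * M) ≡ k * (d * (e * M))
    reassociate = solve-∀

init-++-last : ∀ x xs → x ∷ xs ≡ initZ (x ∷ xs) ++ [ lastZ (x ∷ xs) ]
init-++-last x []       = refl
init-++-last x (y ∷ ys) = cong (x ∷_) (init-++-last y ys)

reverse-init-++-last : ∀ x xs → reverse (x ∷ xs) ≡ lastZ (x ∷ xs) ∷ reverse (initZ (x ∷ xs))
reverse-init-++-last x xs = trans (cong reverse (init-++-last x xs)) (LP.reverse-++ (initZ (x ∷ xs)) _)

map-neg-involutive : ∀ l → map (-_) (map (-_) l) ≡ l
map-neg-involutive l = trans (sym (LP.map-∘ l)) (trans (LP.map-cong ℤP.neg-involutive l) (LP.map-id l))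

clause1-palindrome : ∀ a → reverse (clause1 a) ≡ clause1 a
clause1-palindrome a = trans (LP.reverse-++ a (reverse a)) (cong (_++ reverse a) (LP.reverse-involutive a))

clause2-antipalindrome : ∀ a → reverse (clause2 a) ≡ map (-_) (clause2 a)
clause2-antipalindrome a = begin
  reverse (I ++ 0ℤ ∷ map (-_) (reverse I))
    ≡⟨ LP.reverse-++ I _ ⟩
  reverse (0ℤ ∷ map (-_) (reverse I)) ++ reverse I
    ≡⟨ cong (_++ reverse I) (LP.unfold-reverse 0ℤ (map (-_) (reverse I))) ⟩
  (reverse (map (-_) (reverse I)) ++ [ 0ℤ ]) ++ reverse I
    ≡⟨ cong (λ l → (l ++ [ 0ℤ ]) ++ reverse I) reverse-map-reverse ⟩
  (map (-_) I ++ [ 0ℤ ]) ++ reverse I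
    ≡⟨ LP.++-assoc (map (-_) I) [ 0ℤ ] (reverse I) ⟩
  map (-_) I ++ 0ℤ ∷ reverse I
    ≡⟨ cong (λ l → map (-_) I ++ 0ℤ ∷ l) (sym (map-neg-involutive (reverse I))) ⟩
  map (-_) I ++ map (-_) (0ℤ ∷ map (-_) (reverse I))
    ≡⟨ sym (LP.map-++ (-_) I _) ⟩
  map (-_) (I ++ 0ℤ ∷ map (-_) (reverse I)) ∎
  where
  I = initZ a
  reverse-map-reverse : reverse (map (-_) (reverse I)) ≡ map (-_) I
  reverse-map-reverse = trans (sym (LP.reverse-map (-_) (reverse I))) (cong (map (-_)) (LP.reverse-involutive I))

clause1-shiftDifference : ∀ a → reverse a ≡ map (-_) a → IsShiftDifference (length a) a (clause1 a)
clause1-shiftDifference a antipalindrome = shiftDifference λ F → begin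
  weightedSum (a ++ reverse a) F                                    ≡⟨ weightedSum-++ a (reverse a) F ⟩
  weightedSum a F + weightedSum (reverse a) (λ i → F (length a ℕ.+ i))
    ≡⟨ cong (λ r → weightedSum a F + weightedSum r (λ i → F (length a ℕ.+ i))) antipalindrome ⟩
  weightedSum a F + weightedSum (map (-_) a) (λ i → F (length a ℕ.+ i))
    ≡⟨ cong (_+_ (weightedSum a F)) (weightedSum-neg a _) ⟩
  weightedSum a F - weightedSum a (λ i → F (length a ℕ.+ i))        ∎

-- Since a palindrome a = I ++ [x] has reverse I equal to its tail, clause2 a = I ++ 0 ∷ −(tail a),
-- whose generating polynomial is a(x) − x^(length I)·a(x): the two copies of x·x^(length I) cancel.
clause2-shiftDifference : ∀ x xs → reverse (x ∷ xs) ≡ x ∷ xs →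
                          IsShiftDifference (length (initZ (x ∷ xs))) (x ∷ xs) (clause2 (x ∷ xs))
clause2-shiftDifference x xs palindrome = shiftDifference λ F → begin
  weightedSum (I ++ 0ℤ ∷ map (-_) (reverse I)) F                          ≡⟨ weightedSum-++ I _ F ⟩
  ΣI F + (0ℤ * F (k ℕ.+ 0) + weightedSum (map (-_) (reverse I)) (λ i → F (k ℕ.+ suc i)))
    ≡⟨ cong (λ r → ΣI F + (0ℤ * F (k ℕ.+ 0) + weightedSum (map (-_) r) (λ i → F (k ℕ.+ suc i))))
            reverse-I≡xs ⟩
  ΣI F + (0ℤ * F (k ℕ.+ 0) + weightedSum (map (-_) xs) (λ i → F (k ℕ.+ suc i)))
    ≡⟨ cong (λ u → ΣI F + (0ℤ * F (k ℕ.+ 0) + u)) (weightedSum-neg xs _) ⟩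
  ΣI F + (0ℤ * F (k ℕ.+ 0) + - weightedSum xs (λ i → F (k ℕ.+ suc i)))
    ≡⟨ telescope (ΣI F) (F (k ℕ.+ 0)) x _ ⟩
  (ΣI F + (x * F (k ℕ.+ 0) + 0ℤ)) - weightedSum (x ∷ xs) (λ i → F (k ℕ.+ i))
    ≡⟨ cong (_- weightedSum (x ∷ xs) (λ i → F (k ℕ.+ i))) (sym (weightedSum-++ I [ x ] F)) ⟩
  weightedSum (I ++ [ x ]) F - weightedSum (x ∷ xs) (λ i → F (k ℕ.+ i))
    ≡⟨ cong (λ l → weightedSum l F - weightedSum (x ∷ xs) (λ i → F (k ℕ.+ i))) (sym a≡I++[x]) ⟩
  weightedSum (x ∷ xs) F - weightedSum (x ∷ xs) (λ i → F (k ℕ.+ i)) ∎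
  where
  I = initZ (x ∷ xs)
  k = length I
  ΣI : (ℕ → ℤ) → ℤ
  ΣI = weightedSum I
  last≡x×reverse-I≡xs : lastZ (x ∷ xs) ≡ x × reverse I ≡ xs
  last≡x×reverse-I≡xs = LP.∷-injective (trans (sym (reverse-init-++-last x xs)) palindrome)
  reverse-I≡xs : reverse I ≡ xs
  reverse-I≡xs = proj₂ last≡x×reverse-I≡xs
  a≡I++[x] : x ∷ xs ≡ I ++ [ x ]
  a≡I++[x] = trans (init-++-last x xs) (cong (λ l → I ++ [ l ]) (proj₁ last≡x×reverse-I≡xs))
  telescope : ∀ A f x T → A + (0ℤ * f + - T) ≡ (A + (x * f + 0ℤ)) - (x * f + T)
  telescope = solve-∀

lastZ≡headZ-reverse : ∀ a → lastZ a ≡ headZ (reverse a)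
lastZ≡headZ-reverse []       = refl
lastZ≡headZ-reverse (x ∷ xs) = sym (cong headZ (reverse-init-++-last x xs))

nextP-clause1 : ∀ a → headZ a ≡ - lastZ a → nextP a ≡ clause1 a
nextP-clause1 a head≡-last with headZ a ℤ.≟ - lastZ a
... | yes _         = refl
... | no  head≢-last = contradiction head≡-last head≢-last

nextP-clause2 : ∀ a → headZ a ≢ - lastZ a → nextP a ≡ clause2 a
nextP-clause2 a head≢-last with headZ a ℤ.≟ - lastZ a
... | yes head≡-last = contradiction head≡-last head≢-last
... | no  _          = refl

clause2-shape : ∀ y ys → Σ ℤ λ y′ → Σ (List ℤ) λ ys′ → clause2 (1ℤ ∷ y ∷ ys) ≡ 1ℤ ∷ y′ ∷ ys′
clause2-shape y ys with initZ (y ∷ ys)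
... | []     = 0ℤ , _ , refl
... | z ∷ zs = z  , _ , refl

-- An antipalindrome satisfies a₀ = −aₖ and is extended by clause (i); a palindrome starting with 1
-- has a₀ = aₖ ≠ −aₖ and is extended by clause (ii).
record Invariant (n : ℕ) (a : List ℤ) : Set where
  constructor invariant
  field
    second    : ℤ
    rest      : List ℤ
    shape     : a ≡ 1ℤ ∷ second ∷ rest
    vanishing : Vanishing a n
    signed    : Signed n a
    symmetric : reverse a ≡ map (-_) a ⊎ reverse a ≡ a

invariant-nextP : ∀ {n a} → Invariant n a → Invariant (suc n) (nextP a)
invariant-nextP {n} (invariant y ys refl vanishing signed (inj₁ antipalindrome)) =
  subst (Invariant (suc n)) (sym (nextP-clause1 a head≡-last))
    (invariant y (ys ++ reverse a) refl
      (shiftDifference-vanishing difference vanishing)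
      (shiftDifference-signed difference vanishing signed)
      (inj₂ (clause1-palindrome a)))
  where
  a = 1ℤ ∷ y ∷ ys
  difference = clause1-shiftDifference a antipalindrome
  head≡-last : headZ a ≡ - lastZ a
  head≡-last = cong -_ (trans (sym (cong headZ antipalindrome)) (sym (lastZ≡headZ-reverse a)))
invariant-nextP {n} (invariant y ys refl vanishing signed (inj₂ palindrome)) =
  subst (Invariant (suc n)) (sym (nextP-clause2 a head≢-last))
    (invariant y′ ys′ shape′
      (shiftDifference-vanishing difference vanishing)
      (shiftDifference-signed difference vanishing signed)
      (inj₁ (clause2-antipalindrome a)))
  where
  a = 1ℤ ∷ y ∷ ys
  difference = clause2-shiftDifference 1ℤ (y ∷ ys) palindrome
  y′ = proj₁ (clause2-shape y ys)
  ys′ = proj₁ (proj₂ (clause2-shape y ys))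
  shape′ = proj₂ (proj₂ (clause2-shape y ys))
  head≢-last : headZ a ≢ - lastZ a
  head≢-last 1≡-last with trans 1≡-last (cong -_ (trans (lastZ≡headZ-reverse a) (cong headZ palindrome)))
  ... | ()

invariant-P : ∀ m → Invariant (suc m) (P (suc m))
invariant-P zero    = invariant (- 1ℤ) [] refl vanishing₁ (ℤ.+<+ (s≤s z≤n)) (inj₁ refl)
  where
  vanishing₁ : Vanishing (P 1) 1
  vanishing₁ zero    _         = refl
  vanishing₁ (suc _) (s≤s ())
invariant-P (suc m) = invariant-nextP (invariant-P m)

-1^n≡1⊎-1 : ∀ n → (- 1ℤ) ^ n ≡ 1ℤ ⊎ (- 1ℤ) ^ n ≡ - 1ℤ
-1^n≡1⊎-1 zero    = inj₁ refl
-1^n≡1⊎-1 (suc n) with -1^n≡1⊎-1 n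
... | inj₁ ≡1  = inj₂ (cong (- 1ℤ *_) ≡1)
... | inj₂ ≡-1 = inj₁ (cong (- 1ℤ *_) ≡-1)

sgn-unit : ∀ {ε} M → ε ≡ 1ℤ ⊎ ε ≡ - 1ℤ → 0ℤ ℤ.< ε * M → sgn M ≡ ε
sgn-unit (+ suc _)  (inj₁ refl) _          = refl
sgn-unit (+ zero)   (inj₁ refl) (ℤ.+<+ ())
sgn-unit -[1+ _ ]   (inj₁ refl) ()
sgn-unit -[1+ _ ]   (inj₂ refl) _          = refl
sgn-unit (+ zero)   (inj₂ refl) (ℤ.+<+ ())
sgn-unit (+ suc _)  (inj₂ refl) ()

corollary1 : (n : ℕ) → 1 ≤ n →
    ((s : ℕ) → s < n → moment (P n) s ≡ 0ℤ) × (sgn (moment (P n) n) ≡ (- 1ℤ) ^ n)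
corollary1 zero    ()
corollary1 (suc m) _ =
  (λ s s<n → trans (moment≡moment′ (P (suc m)) s) (vanishing s s<n)) ,
  trans (cong sgn (moment≡moment′ (P (suc m)) (suc m))) (sgn-unit _ (-1^n≡1⊎-1 (suc m)) signed)
  where
  open Invariant (invariant-P m)
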